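{- Let $p$ be a prime and let $q$ be a prime with $q^2\mid 2^p-1$. Let $w\ge 2$ be an integer. Then $q^w$ exactly divides $2^p-1$ (i.e. $q^w\mid 2^p-1$ and $q^{w+1}\nmid 2^p-1$) if and only if $q$ is a Wieferich prime of order $w-1$.
   Context: A prime $q$ is a Wieferich prime of order $v\ge1$ if $q^{v+1}$ exactly divides $2^{q-1}-1$, i.e. $q^{v+1}\mid 2^{q-1}-1$ and $q^{v+2}\nmid 2^{q-1}-1$. -}

module Defs where

open import Data.Nat using (ℕ; suc; _^_; _∸_; _≥_)
open import Data.Nat.Divisibility using (_∣_)
open import Data.Nat.Primality using (Prime)
open import Data.Product using (_×_)
open import Relation.Nullary using (¬_)

ExactlyDivides : ℕ → ℕ → ℕ → Set
ExactlyDivides d k n = (d ^ k ∣ n) × ¬ (d ^ suc k ∣ n)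

WieferichOfOrder : ℕ → ℕ → Set
WieferichOfOrder v q = Prime q × v ≥ 1 × ExactlyDivides q (suc v) (2 ^ (q ∸ 1) ∸ 1)

-- Since q ∣ 2^p − 1 with p prime, p is the order of 2 modulo q, and q − 1 = t p by Fermat.
-- Then 2^(q−1) − 1 = (2^p − 1)(1 + 2^p + … + 2^((t−1)p)), and the second factor is ≡ t
-- modulo q with 0 < t < q, so it is prime to q: both numbers carry the same power of q.
{-# OPTIONS --safe #-}
module Submission where

open import Data.Nat
open import Data.Nat.Properties
open import Data.Nat.Combinatorics using (_C_; nCk+nC[k+1]≡[n+1]C[k+1]; k>n⇒nCk≡0; nCn≡1; nC1≡n)
open import Data.Nat.Coprimality using (Coprime; coprime-Bézout; prime⇒coprime)
open import Data.Nat.Divisibility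
open import Data.Nat.DivMod using (_/_; _%_; m≡m%n+[m/n]*n; m%n<n)
open import Data.Nat.GCD using (module Bézout)
open import Data.Nat.Primality
open import Data.Nat.Tactic.RingSolver using (solve-∀)
open import Data.Product using (∃-syntax; _,_)
open import Data.Sum using (inj₁; inj₂)
open import Function.Base using (_∘_)
open import Function.Bundles using (_⇔_; mk⇔; module Equivalence)
open import Relation.Binary.PropositionalEquality
open import Relation.Nullary using (¬_; contradiction)

open import Defs

[k+1]*[n+1]C[k+1]≡[n+1]*nCk : ∀ n k → suc k * (suc n C suc k) ≡ suc n * (n C k)
[k+1]*[n+1]C[k+1]≡[n+1]*nCk zero zero = refl
[k+1]*[n+1]C[k+1]≡[n+1]*nCk zero (suc k)
  rewrite k>n⇒nCk≡0 {1} {suc (suc k)} (s≤s (s≤s z≤n)) | *-zeroʳ k = refl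
[k+1]*[n+1]C[k+1]≡[n+1]*nCk (suc n) zero rewrite nC1≡n (suc (suc n)) = *-comm 1 (suc (suc n))
[k+1]*[n+1]C[k+1]≡[n+1]*nCk (suc n) (suc j) = begin
  suc (suc j) * (suc (suc n) C suc (suc j))
    ≡⟨ cong (suc (suc j) *_) (nCk+nC[k+1]≡[n+1]C[k+1] (suc n) (suc j)) ⟨
  suc (suc j) * (a + b)
    ≡⟨ *-distribˡ-+ (suc (suc j)) a b ⟩
  (a + suc j * a) + suc (suc j) * b
    ≡⟨ cong₂ (λ x y → (a + x) + y) ([k+1]*[n+1]C[k+1]≡[n+1]*nCk n j)
                                   ([k+1]*[n+1]C[k+1]≡[n+1]*nCk n (suc j)) ⟩
  (a + suc n * (n C j)) + suc n * (n C suc j)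
    ≡⟨ +-assoc a _ _ ⟩
  a + (suc n * (n C j) + suc n * (n C suc j))
    ≡⟨ cong (a +_) (*-distribˡ-+ (suc n) (n C j) (n C suc j)) ⟨
  a + suc n * (n C j + n C suc j)
    ≡⟨ cong (λ x → a + suc n * x) (nCk+nC[k+1]≡[n+1]C[k+1] n j) ⟩
  suc (suc n) * a
    ∎
  where
  open ≡-Reasoning
  a = suc n C suc j
  b = suc n C suc (suc j)

prime∣pCk : ∀ {n} → Prime (suc n) → ∀ {k} → k < n → suc n ∣ suc n C suc k
prime∣pCk {n} pr {k} k<n
  with euclidsLemma (suc k) (suc n C suc k) pr
         (divides (n C k) (trans ([k+1]*[n+1]C[k+1]≡[n+1]*nCk n k) (*-comm (suc n) (n C k))))
... | inj₁ p∣k+1 = contradiction (∣⇒≤ p∣k+1) (<⇒≱ (s≤s k<n))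
... | inj₂ p∣pCk = p∣pCk

rowSum : ℕ → ℕ → ℕ
rowSum n zero    = 0
rowSum n (suc j) = rowSum n j + n C j

rowSum-pascal : ∀ n j → rowSum (suc n) (suc j) ≡ rowSum n (suc j) + rowSum n j
rowSum-pascal n zero    = refl
rowSum-pascal n (suc j) = begin
  rowSum (suc n) (suc j) + suc n C suc j
    ≡⟨ cong₂ _+_ (rowSum-pascal n j) (sym (nCk+nC[k+1]≡[n+1]C[k+1] n j)) ⟩
  (rowSum n (suc j) + rowSum n j) + (n C j + n C suc j)
    ≡⟨ interchange (rowSum n (suc j)) (rowSum n j) (n C j) (n C suc j) ⟩
  (rowSum n (suc j) + n C suc j) + (rowSum n j + n C j)
    ∎
  where
  open ≡-Reasoning
  interchange : ∀ a b c d → (a + b) + (c + d) ≡ (a + d) + (b + c)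
  interchange = solve-∀

rowSum≡2^n : ∀ n → rowSum n (suc n) ≡ 2 ^ n
rowSum≡2^n zero    = refl
rowSum≡2^n (suc n) = begin
  rowSum (suc n) (suc (suc n))
    ≡⟨ rowSum-pascal n (suc n) ⟩
  (rowSum n (suc n) + n C suc n) + rowSum n (suc n)
    ≡⟨ cong₂ (λ x y → (x + y) + x) (rowSum≡2^n n) (k>n⇒nCk≡0 (n<1+n n)) ⟩
  (2 ^ n + 0) + 2 ^ n
    ≡⟨ cong (_+ 2 ^ n) (+-identityʳ (2 ^ n)) ⟩
  2 ^ n + 2 ^ n
    ≡⟨ cong (2 ^ n +_) (+-identityʳ (2 ^ n)) ⟨
  2 * 2 ^ n
    ∎
  where open ≡-Reasoning

rowSum>0 : ∀ n j → 0 < rowSum n (suc j)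
rowSum>0 n zero    = s≤s z≤n
rowSum>0 n (suc j) = ≤-trans (rowSum>0 n j) (m≤m+n (rowSum n (suc j)) (n C suc j))

prime∣rowSum∸1 : ∀ {n} → Prime (suc n) → ∀ {j} → j ≤ n → suc n ∣ rowSum (suc n) (suc j) ∸ 1
prime∣rowSum∸1 {n} pr {zero}  _   = suc n ∣0
prime∣rowSum∸1 {n} pr {suc j} j<n = subst (suc n ∣_) (sym (+-∸-comm _ (rowSum>0 (suc n) j)))
  (∣m∣n⇒∣m+n (prime∣rowSum∸1 pr (<⇒≤ j<n)) (prime∣pCk pr j<n))

prime∣2^p∸2 : ∀ {p} → Prime p → p ∣ 2 ^ p ∸ 2
prime∣2^p∸2 {suc n} pr = subst (suc n ∣_) 2^p∸2≡ (prime∣rowSum∸1 pr (≤-refl {n}))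
  where
  open ≡-Reasoning
  2^p∸2≡ : rowSum (suc n) (suc n) ∸ 1 ≡ 2 ^ suc n ∸ 2
  2^p∸2≡ = begin
    suc (rowSum (suc n) (suc n)) ∸ 2   ≡⟨ cong (_∸ 2) (+-comm 1 (rowSum (suc n) (suc n))) ⟩
    rowSum (suc n) (suc n) + 1 ∸ 2     ≡⟨ cong (λ x → rowSum (suc n) (suc n) + x ∸ 2) (nCn≡1 (suc n)) ⟨
    rowSum (suc n) (suc (suc n)) ∸ 2   ≡⟨ cong (_∸ 2) (rowSum≡2^n (suc n)) ⟩
    2 ^ suc n ∸ 2                      ∎

prime∣2^[p∸1]∸1 : ∀ {p} → Prime p → ¬ p ∣ 2 → p ∣ 2 ^ (p ∸ 1) ∸ 1
prime∣2^[p∸1]∸1 {suc n} pr p∤2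
  with euclidsLemma 2 (2 ^ n ∸ 1) pr
         (subst (suc n ∣_) (sym (*-distribˡ-∸ 2 (2 ^ n) 1)) (prime∣2^p∸2 pr))
... | inj₁ p∣2 = contradiction p∣2 p∤2
... | inj₂ p∣M = p∣M

mersenne : ℕ → ℕ
mersenne n = 2 ^ n ∸ 1

2^n≡1+mersenne : ∀ n → 2 ^ n ≡ 1 + mersenne n
2^n≡1+mersenne n = sym (m+[n∸m]≡n (m^n>0 2 n))

mersenne-+ : ∀ m n → mersenne (m + n) ≡ 2 ^ m * mersenne n + mersenne m
mersenne-+ m n = suc-injective (begin
  1 + mersenne (m + n)                     ≡⟨ 2^n≡1+mersenne (m + n) ⟨
  2 ^ (m + n)                              ≡⟨ ^-distribˡ-+-* 2 m n ⟩
  2 ^ m * 2 ^ n                            ≡⟨ cong₂ _*_ (2^n≡1+mersenne m) (2^n≡1+mersenne n) ⟩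
  (1 + mersenne m) * (1 + mersenne n)      ≡⟨ expand (mersenne m) (mersenne n) ⟩
  1 + ((1 + mersenne m) * mersenne n + mersenne m)
    ≡⟨ cong (λ x → 1 + (x * mersenne n + mersenne m)) (2^n≡1+mersenne m) ⟨
  1 + (2 ^ m * mersenne n + mersenne m)    ∎)
  where
  open ≡-Reasoning
  expand : ∀ x y → (1 + x) * (1 + y) ≡ 1 + ((1 + x) * y + x)
  expand = solve-∀

geometric : ℕ → ℕ → ℕ
geometric a zero    = 0
geometric a (suc t) = 1 + a * geometric a t

mersenne-* : ∀ n t → mersenne (t * n) ≡ mersenne n * geometric (2 ^ n) t
mersenne-* n zero    = sym (*-zeroʳ (mersenne n))
mersenne-* n (suc t) = begin
  mersenne (n + t * n)
    ≡⟨ mersenne-+ n (t * n) ⟩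
  2 ^ n * mersenne (t * n) + mersenne n
    ≡⟨ cong (λ x → 2 ^ n * x + mersenne n) (mersenne-* n t) ⟩
  2 ^ n * (mersenne n * geometric (2 ^ n) t) + mersenne n
    ≡⟨ factor (2 ^ n) (mersenne n) (geometric (2 ^ n) t) ⟩
  mersenne n * (1 + 2 ^ n * geometric (2 ^ n) t)
    ∎
  where
  open ≡-Reasoning
  factor : ∀ a x g → a * (x * g) + x ≡ x * (1 + a * g)
  factor = solve-∀

mersenne∣mersenne-* : ∀ n t → mersenne n ∣ mersenne (t * n)
mersenne∣mersenne-* n t =
  divides (geometric (2 ^ n) t) (trans (mersenne-* n t) (*-comm (mersenne n) (geometric (2 ^ n) t)))

∣mersenne⇒∣mersenne-* : ∀ {d n} → d ∣ mersenne n → ∀ t → d ∣ mersenne (t * n)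
∣mersenne⇒∣mersenne-* {n = n} d∣Mn t = ∣-trans d∣Mn (mersenne∣mersenne-* n t)

∣mersenne-+⇒∣mersenne : ∀ {d} m n → d ∣ mersenne n → d ∣ mersenne (m + n) → d ∣ mersenne m
∣mersenne-+⇒∣mersenne {d} m n d∣Mn d∣Mm+n =
  ∣m+n∣m⇒∣n (subst (d ∣_) (mersenne-+ m n) d∣Mm+n) (∣n⇒∣m*n (2 ^ m) d∣Mn)

-- Bézout gives multiples k and 1 + k of m and n (in some order), and mersenne 1 = 1.
coprime⇒∣mersenne⇒∣1 : ∀ {d m n} → Coprime m n → d ∣ mersenne m → d ∣ mersenne n → d ∣ 1
coprime⇒∣mersenne⇒∣1 {d} {m} {n} m⊥n d∣Mm d∣Mn with coprime-Bézout m⊥n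
... | Bézout.+- x y 1+yn≡xm = ∣mersenne-+⇒∣mersenne 1 (y * n) (∣mersenne⇒∣mersenne-* d∣Mn y)
  (subst (λ k → d ∣ mersenne k) (sym 1+yn≡xm) (∣mersenne⇒∣mersenne-* d∣Mm x))
... | Bézout.-+ x y 1+xm≡yn = ∣mersenne-+⇒∣mersenne 1 (x * m) (∣mersenne⇒∣mersenne-* d∣Mm x)
  (subst (λ k → d ∣ mersenne k) (sym 1+xm≡yn) (∣mersenne⇒∣mersenne-* d∣Mn y))

prime-order-divides : ∀ {p d} m → Prime p → .{{NonTrivial d}} →
                      d ∣ mersenne p → d ∣ mersenne m → p ∣ m
prime-order-divides {p} {d} m pp d∣Mp d∣Mm = remainder-case (m % p) (m%n<n m p) refl d∣M[m%p]
  where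
  instance _ = prime⇒nonZero pp
  d∣M[m%p] : d ∣ mersenne (m % p)
  d∣M[m%p] = ∣mersenne-+⇒∣mersenne (m % p) (m / p * p)
    (∣mersenne⇒∣mersenne-* d∣Mp (m / p))
    (subst (λ k → d ∣ mersenne k) (m≡m%n+[m/n]*n m p) d∣Mm)
  remainder-case : ∀ r → r < p → m % p ≡ r → d ∣ mersenne r → p ∣ m
  remainder-case zero    _   m%p≡0 _     = m%n≡0⇒n∣m m p m%p≡0
  remainder-case (suc r) r<p _     d∣Mr =
    contradiction (∣1⇒≡1 (coprime⇒∣mersenne⇒∣1 (prime⇒coprime pp r<p) d∣Mp d∣Mr)) nonTrivial⇒≢1

geometric-mod : ∀ a t → ∃[ h ] geometric (suc a) t ≡ t + a * h
geometric-mod a zero    = 0 , sym (*-zeroʳ a)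
geometric-mod a (suc t) with geometric-mod a t
... | h , eq = t + h + a * h , trans (cong (λ g → 1 + suc a * g) eq) (expand a t h)
  where
  expand : ∀ a t h → 1 + (1 + a) * (t + a * h) ≡ 1 + t + a * (t + h + a * h)
  expand = solve-∀

∣geometric⇒∣ : ∀ {d a t} → d ∣ a → d ∣ geometric (suc a) t → d ∣ t
∣geometric⇒∣ {d} {a} {t} d∣a d∣G with geometric-mod a t
... | h , eq = ∣m+n∣m⇒∣n (subst (d ∣_) (trans eq (+-comm t (a * h))) d∣G) (∣m⇒∣m*n h d∣a)

prime^∣*⇒^∣ : ∀ {q g} → Prime q → ¬ q ∣ g → ∀ j x → q ^ j ∣ x * g → q ^ j ∣ x
prime^∣*⇒^∣ pq q∤g zero    x _ = 1∣ x
prime^∣*⇒^∣ {q} {g} pq q∤g (suc j) x q^[1+j]∣xg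
  with euclidsLemma x g pq (∣-trans (m∣m*n (q ^ j)) q^[1+j]∣xg)
... | inj₂ q∣g = contradiction q∣g q∤g
... | inj₁ (divides y refl) = subst (q * q ^ j ∣_) (*-comm q y) (*-monoʳ-∣ q q^j∣y)
  where
  instance _ = prime⇒nonZero pq
  q^j∣y : q ^ j ∣ y
  q^j∣y = prime^∣*⇒^∣ pq q∤g j y
    (*-cancelˡ-∣ q (subst (q * q ^ j ∣_) (trans (cong (_* g) (*-comm y q)) (*-assoc q y g)) q^[1+j]∣xg))

exactlyDivides-* : ∀ {q g} → Prime q → ¬ q ∣ g →
                   ∀ k x → ExactlyDivides q k x ⇔ ExactlyDivides q k (x * g)
exactlyDivides-* {q} {g} pq q∤g k x = mk⇔
  (λ (q^k∣x , q^[1+k]∤x) → ∣m⇒∣m*n g q^k∣x , q^[1+k]∤x ∘ cancel (suc k))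
  (λ (q^k∣xg , q^[1+k]∤xg) → cancel k q^k∣xg , q^[1+k]∤xg ∘ ∣m⇒∣m*n g)
  where
  cancel : ∀ j → q ^ j ∣ x * g → q ^ j ∣ x
  cancel j = prime^∣*⇒^∣ pq q∤g j x

∤-quotient-of-pred : ∀ {m p t} → .{{NonTrivial m}} → .{{NonZero p}} → m ∸ 1 ≡ t * p → ¬ m ∣ t
∤-quotient-of-pred {2+ _} {t = zero}  ()
∤-quotient-of-pred {m@(2+ _)} {p} {suc t} m∸1≡tp m∣t =
  <⇒≱ (n<1+n (m ∸ 1)) (≤-trans (∣⇒≤ m∣t) (subst (suc t ≤_) (sym m∸1≡tp) (m≤m*n (suc t) p)))

exactlyDivides-mersenne[p]⇔mersenne[q∸1] : ∀ {p q} → Prime p → Prime q → q ∣ mersenne p →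
  ∀ k → ExactlyDivides q k (mersenne p) ⇔ ExactlyDivides q k (mersenne (q ∸ 1))
exactlyDivides-mersenne[p]⇔mersenne[q∸1] {p@(suc p′)} {q} pp pq q∣Mp k =
  subst (λ n → ExactlyDivides q k (mersenne p) ⇔ ExactlyDivides q k n) (sym M[q∸1]≡)
    (exactlyDivides-* pq q∤G k (mersenne p))
  where
  instance
    _ = prime⇒nonTrivial pq
    _ = prime⇒nonZero pp
  q∤2 : ¬ q ∣ 2
  q∤2 q∣2 = nonTrivial⇒≢1 (∣1⇒≡1 (∣m+n∣m⇒∣n q∣Mp+1 q∣Mp))
    where
    q∣Mp+1 : q ∣ mersenne p + 1
    q∣Mp+1 = subst (q ∣_) (trans (2^n≡1+mersenne p) (+-comm 1 (mersenne p))) (∣m⇒∣m*n (2 ^ p′) q∣2)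
  p∣q∸1 : p ∣ q ∸ 1
  p∣q∸1 = prime-order-divides (q ∸ 1) pp q∣Mp (prime∣2^[p∸1]∸1 pq q∤2)
  t = quotient p∣q∸1
  M[q∸1]≡ : mersenne (q ∸ 1) ≡ mersenne p * geometric (2 ^ p) t
  M[q∸1]≡ = trans (cong mersenne (m∣n⇒n≡quotient*m p∣q∸1)) (mersenne-* p t)
  q∤G : ¬ q ∣ geometric (2 ^ p) t
  q∤G q∣G = ∤-quotient-of-pred {q} {p} {t} (m∣n⇒n≡quotient*m p∣q∸1)
    (∣geometric⇒∣ {q} {mersenne p} {t} q∣Mp
      (subst (λ a → q ∣ geometric a t) (2^n≡1+mersenne p) q∣G))

theorem6 : (p q w : ℕ) → Prime p → Prime q → q ^ 2 ∣ 2 ^ p ∸ 1 → w ≥ 2 →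
    ExactlyDivides q w (2 ^ p ∸ 1) ⇔ WieferichOfOrder (w ∸ 1) q
theorem6 p q (suc (suc w)) pp pq q²∣Mp (s≤s (s≤s _)) = mk⇔
  (λ e → pq , s≤s z≤n , to e)
  (λ (_ , _ , e) → from e)
  where
  q∣Mp : q ∣ mersenne p
  q∣Mp = ∣-trans (m∣m*n (q * 1)) q²∣Mp
  open Equivalence (exactlyDivides-mersenne[p]⇔mersenne[q∸1] pp pq q∣Mp (suc (suc w)))
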